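{- For $n\ge 0$, $$\left|\mathcal{S}^2_n(123)\right|=\frac{1}{2n+1}\binom{3n}{n}.$$
   Context: $\mathcal{S}^2_n(P)$ denotes the set of permutations $\pi\in\mathcal{S}_{3n}$ that avoid every pattern in $P$ (in the classical sense: no subsequence order-isomorphic to a pattern in $P$) and satisfy $\pi_{3i+1}<\pi_{3i+2}$ and $\pi_{3i+1}<\pi_{3i+3}$ for all $0\le i<n$. (These are the permutations of $P$-avoiding binary shrub forests: each block of three consecutive positions is a root followed by its two leaves.) -}

module Defs where

open import Data.Nat using (ℕ; _+_; _*_; suc)
open import Data.Nat.Combinatorics using (_C_)
open import Data.Nat.DivMod using (_/_)
open import Data.Fin using (Fin; _<_; toℕ)
open import Data.Fin.Patterns using (0F; 1F; 2F)
open import Data.Vec using (Vec; lookup)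
open import Data.List using (List; length)
open import Data.List.Membership.Propositional using (_∈_)
open import Data.List.Relation.Unary.Unique.Propositional using (Unique)
open import Data.Product using (_×_; Σ; ∃)
open import Relation.Nullary using (¬_)
open import Relation.Binary.PropositionalEquality using (_≡_)
open import Data.Nat.Properties using (*-comm)

-- A permutation of {0,…,m-1} in one-line notation: the word π₀ π₁ … π_{m-1},
-- with every value occurring exactly once (for length-m words over Fin m,
-- injectivity is equivalent to bijectivity).
IsPerm : {m : ℕ} → Vec (Fin m) m → Set
IsPerm {m} w = ∀ (i j : Fin m) → lookup w i ≡ lookup w j → i ≡ j

Contains123 : {m : ℕ} → Vec (Fin m) m → Set
Contains123 {m} w =
  Σ (Fin m) λ i → Σ (Fin m) λ j → Σ (Fin m) λ k →
    (i < j) × (j < k) × (lookup w i < lookup w j) × (lookup w j < lookup w k)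

Avoids123 : {m : ℕ} → Vec (Fin m) m → Set
Avoids123 w = ¬ Contains123 w

-- Position 3i+r (r ∈ {0,1,2}, 0-indexed) inside a word of length 3n.
pos : {n : ℕ} → Fin n → Fin 3 → Fin (3 * n)
pos {n} i r = Data.Fin.cast (*-comm n 3) (Data.Fin.combine i r)
  where import Data.Fin

-- Shrub condition (0-indexed): π_{3i} < π_{3i+1} and π_{3i} < π_{3i+2}
-- (the paper's 1-indexed π_{3i+1} < π_{3i+2}, π_{3i+1} < π_{3i+3}).
Shrub : {n : ℕ} → Vec (Fin (3 * n)) (3 * n) → Set
Shrub {n} w = ∀ (i : Fin n) →
  (lookup w (pos {n} i 0F) < lookup w (pos {n} i 1F)) ×
  (lookup w (pos {n} i 0F) < lookup w (pos {n} i 2F))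

InS2-123 : (n : ℕ) → Vec (Fin (3 * n)) (3 * n) → Set
InS2-123 n w = IsPerm w × Avoids123 w × Shrub {n} w

HasCard : {A : Set} → (A → Set) → ℕ → Set
HasCard {A} P k = Σ (List A) λ xs →
  Unique xs × (∀ x → x ∈ xs → P x) × (∀ x → P x → x ∈ xs) × (length xs ≡ k)

-- Read a word of S²_n(123) as n blocks (root, leaf, leaf).  Avoiding 123 forces
-- the roots to be descending and the leaves to be descending; conversely,
-- interleaving a descending root sequence R (n entries) with a descending leaf
-- sequence L (2n entries) that together partition {0,…,3n−1}, every root lying
-- below its two leaves, always yields a word of S²_n(123).  Such "admissible"
-- pairs are listed by `pairs a r` (a leaves, r roots), built by deciding whether
-- the smallest value 0 is the last leaf or the last root.  The length of that list
-- satisfies a ballot recursion whose solution is C(a+r,r) − 2·C(a+r,r−1); at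
-- (a, r) = (2n, n) this equals C(3n,n)/(2n+1).

module Submission where

open import Defs
open import Data.Nat using (ℕ; suc; _*_)
open import Data.Nat.Combinatorics using (_C_)
open import Data.Nat.DivMod using (_/_)

open import Function using (_∘_)
open import Data.Nat using (zero; _+_; _≤_; _<_; _≤?_; _<?_; z≤n; s≤s)
open import Data.Nat.Properties
open import Data.Nat.Combinatorics using (nC1≡n; nCk+nC[k+1]≡[n+1]C[k+1]; k>n⇒nCk≡0)
open import Data.Nat.DivMod using (m*n/n≡m)
open import Data.Nat.Tactic.RingSolver using (solve-∀)
open import Data.Fin as Fin using (Fin; toℕ; fromℕ<)
open import Data.Fin.Properties as FinP using (toℕ<n; toℕ-fromℕ<; fromℕ<-toℕ; toℕ-injective; toℕ-cast; toℕ-combine; punchOut-injective; pigeonhole; any?)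
open import Data.Fin.Patterns using (0F; 1F; 2F)
open import Data.Vec using (Vec; []; _∷_; lookup)
open import Data.List using (List; []; _∷_; _++_; [_]; map; length)
open import Data.List.Properties using (length-map; length-++; map-injective; ∷ʳ-injectiveˡ; map-∘; map-id-local)
open import Data.List.Membership.Propositional using (_∈_; _∉_; find; lose)
open import Data.List.Membership.Propositional.Properties using (∈-map⁺; ∈-map⁻; ∈-++⁺ˡ; ∈-++⁺ʳ; ∈-++⁻)
open import Data.List.Relation.Unary.Any using (Any; here; there)
open import Data.List.Relation.Unary.All as All using (All; []; _∷_)
import Data.List.Relation.Unary.All.Properties as AllP
open import Data.List.Relation.Unary.AllPairs as AllPairs using (AllPairs; []; _∷_)
import Data.List.Relation.Unary.AllPairs.Properties as AllPairsP
open import Data.List.Relation.Unary.Unique.Propositional using (Unique)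
import Data.List.Relation.Unary.Unique.Propositional.Properties as UniqueP
open import Data.Product using (Σ; ∃; _×_; _,_; proj₁; proj₂)
open import Data.Sum as Sum using (_⊎_; inj₁; inj₂)
open import Data.Unit using (⊤; tt)
open import Data.Empty using (⊥; ⊥-elim)
open import Relation.Nullary using (Dec; yes; no; ¬_)
open import Relation.Binary.PropositionalEquality hiding ([_])

module BallotNumbers where

  open ≡-Reasoning

  pascal : ∀ n k → n C k + n C suc k ≡ suc n C suc k
  pascal = nCk+nC[k+1]≡[n+1]C[k+1]

  absorption : ∀ n k → suc k * (suc n C suc k) ≡ suc n * (n C k)
  absorption zero    zero    = refl
  absorption zero    (suc k) =
    trans (cong (suc (suc k) *_) (k>n⇒nCk≡0 {1} {suc (suc k)} (s≤s (s≤s z≤n)))) (*-zeroʳ (suc (suc k)))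
  absorption (suc n) zero    = begin
    1 * (suc (suc n) C 1) ≡⟨ *-identityˡ _ ⟩
    suc (suc n) C 1       ≡⟨ nC1≡n (suc (suc n)) ⟩
    suc (suc n)           ≡⟨ *-identityʳ _ ⟨
    suc (suc n) * 1       ∎
  absorption (suc n) (suc k) = begin
    suc (suc k) * (suc (suc n) C suc (suc k))
      ≡⟨ cong (suc (suc k) *_) (pascal (suc n) (suc k)) ⟨
    suc (suc k) * (suc n C suc k + suc n C suc (suc k))
      ≡⟨ *-distribˡ-+ (suc (suc k)) (suc n C suc k) _ ⟩
    suc (suc k) * (suc n C suc k) + suc (suc k) * (suc n C suc (suc k))
      ≡⟨ cong (suc (suc k) * (suc n C suc k) +_) (absorption n (suc k)) ⟩
    (suc n C suc k + suc k * (suc n C suc k)) + suc n * (n C suc k)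
      ≡⟨ cong (λ z → (suc n C suc k + z) + suc n * (n C suc k)) (absorption n k) ⟩
    (suc n C suc k + suc n * (n C k)) + suc n * (n C suc k)
      ≡⟨ +-assoc (suc n C suc k) _ _ ⟩
    suc n C suc k + (suc n * (n C k) + suc n * (n C suc k))
      ≡⟨ cong (suc n C suc k +_) (*-distribˡ-+ (suc n) (n C k) (n C suc k)) ⟨
    suc n C suc k + suc n * (n C k + n C suc k)
      ≡⟨ cong (λ z → suc n C suc k + suc n * z) (pascal n k) ⟩
    suc n C suc k + suc n * (suc n C suc k)
      ∎

  binomial-ratio : ∀ k s → suc k * ((k + s) C suc k) ≡ s * ((k + s) C k)
  binomial-ratio k s = +-cancelˡ-≡ (suc k * X) _ _ (begin
    suc k * X + suc k * ((k + s) C suc k) ≡⟨ *-distribˡ-+ (suc k) X _ ⟨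
    suc k * (X + (k + s) C suc k)        ≡⟨ cong (suc k *_) (pascal (k + s) k) ⟩
    suc k * (suc (k + s) C suc k)        ≡⟨ absorption (k + s) k ⟩
    suc (k + s) * X                      ≡⟨ *-distribʳ-+ X (suc k) s ⟩
    suc k * X + s * X                    ∎)
    where X = (k + s) C k

  onlyIf : {P : Set} → Dec P → ℕ → ℕ
  onlyIf (yes _) x = x
  onlyIf (no _)  _ = 0

  -- ballot a r: arrangements with a leaves and r roots (see `pairs` below).  The
  -- smallest value is either the last leaf, or the last root, which needs its two
  -- leaves to exist already: 2(r+1) ≤ a+1.
  ballot : ℕ → ℕ → ℕ
  ballot zero    zero    = 1
  ballot (suc a) zero    = ballot a zero
  ballot zero    (suc r) = 0
  ballot (suc a) (suc r) = ballot a (suc r) + onlyIf (2 * suc r ≤? suc a) (ballot (suc a) r)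

  ballot-no-roots : ∀ a → ballot a zero ≡ 1
  ballot-no-roots zero    = refl
  ballot-no-roots (suc a) = ballot-no-roots a

  ballot-too-many-roots : ∀ a r → suc a < 2 * r → ballot a r ≡ 0
  ballot-too-many-roots a       zero    ()
  ballot-too-many-roots zero    (suc r) _ = refl
  ballot-too-many-roots (suc a) (suc r) lt with 2 * suc r ≤? suc a
  ... | yes fits = ⊥-elim (<-irrefl refl (<-≤-trans lt (≤-trans fits (n≤1+n (suc a)))))
  ... | no  _    = trans (+-identityʳ _) (ballot-too-many-roots a (suc r) (<-trans (n<1+n (suc a)) lt))

  -- C(a+r, r−1) (and 0 for r = 0): the term removed by the reflection principle.
  reflected : ℕ → ℕ → ℕ
  reflected a zero    = 0
  reflected a (suc r) = (a + suc r) C r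

  reflected-pascal : ∀ a r → reflected (suc a) r + (a + suc r) C r ≡ (suc a + suc r) C r
  reflected-pascal a zero    = refl
  reflected-pascal a (suc r) =
    trans (cong (λ z → z C r + (a + suc (suc r)) C suc r) (sym (+-suc a (suc r))))
          (pascal (a + suc (suc r)) r)

  forced-boundary : ∀ a r → ¬ (2 * suc r ≤ suc a) → 2 * suc r ≤ suc (suc a) → a ≡ 2 * r
  forced-boundary a r full room = ≤-antisym
    (≤-pred (≤-pred (≰⇒> (full ∘ subst (_≤ suc a) (sym (*-suc 2 r))))))
    (≤-pred (≤-pred (subst (_≤ suc (suc a)) (*-suc 2 r) room)))

  boundary-binomial : ∀ r → (suc (2 * r) + suc r) C suc r ≡ 2 * ((suc (2 * r) + suc r) C r)
  boundary-binomial r = subst (λ N → N C suc r ≡ 2 * (N C r)) (sym (size r))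
    (*-cancelˡ-≡ _ _ (suc r) (trans (binomial-ratio r (2 * suc r)) (regroup r _)))
    where
    size : ∀ r → suc (2 * r) + suc r ≡ r + 2 * suc r
    size = solve-∀
    regroup : ∀ r X → 2 * suc r * X ≡ suc r * (2 * X)
    regroup = solve-∀

  -- Induction along the recursion of `ballot`, using Pascal's rule on both sides;
  -- at the boundary a = 2r the root branch is empty and boundary-binomial applies.
  ballot-formula : ∀ a r → 2 * r ≤ suc a → ballot a r + 2 * reflected a r ≡ (a + r) C r
  ballot-formula zero    zero    _ = refl
  ballot-formula (suc a) zero    _ = trans (+-identityʳ _) (ballot-no-roots a)
  ballot-formula zero    (suc r) (s≤s le) = ⊥-elim (n≮0 (≤-trans (m≤n+m (suc (r + 0)) r) le))
  ballot-formula (suc a) (suc r) room with 2 * suc r ≤? suc a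
  ... | yes fits = begin
     ballot a (suc r) + ballot (suc a) r + 2 * ((suc a + suc r) C r)
       ≡⟨ cong (λ z → ballot a (suc r) + ballot (suc a) r + 2 * z) (reflected-pascal a r) ⟨
     ballot a (suc r) + ballot (suc a) r + 2 * (reflected (suc a) r + (a + suc r) C r)
       ≡⟨ regroup (ballot a (suc r)) (ballot (suc a) r) ((a + suc r) C r) (reflected (suc a) r) ⟩
     (ballot a (suc r) + 2 * ((a + suc r) C r)) + (ballot (suc a) r + 2 * reflected (suc a) r)
       ≡⟨ cong₂ _+_ (ballot-formula a (suc r) fits)
                    (ballot-formula (suc a) r (≤-trans (*-monoʳ-≤ 2 (n≤1+n r)) room)) ⟩
     (a + suc r) C suc r + (suc a + r) C r
       ≡⟨ cong (λ z → (a + suc r) C suc r + z C r) (+-suc a r) ⟨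
     (a + suc r) C suc r + (a + suc r) C r
       ≡⟨ +-comm ((a + suc r) C suc r) _ ⟩
     (a + suc r) C r + (a + suc r) C suc r
       ≡⟨ pascal (a + suc r) r ⟩
     (suc a + suc r) C suc r ∎
    where
    regroup : ∀ x y A B → x + y + 2 * (B + A) ≡ (x + 2 * A) + (y + 2 * B)
    regroup = solve-∀
  ... | no full with forced-boundary a r full room
  ... | refl = begin
     ballot (2 * r) (suc r) + 0 + 2 * (N C r)
       ≡⟨ cong (λ z → z + 0 + 2 * (N C r)) (ballot-too-many-roots (2 * r) (suc r) beyond) ⟩
     2 * (N C r)
       ≡⟨ boundary-binomial r ⟨
     N C suc r ∎
    where
    N = suc (2 * r) + suc r
    beyond : suc (2 * r) < 2 * suc r
    beyond = ≤-reflexive (sym (*-suc 2 r))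

  -- ballot (2n) n · (2n+1) = C(3n, n): combine ballot-formula at (2n, n) with
  -- n·C(3n, n) = (2n+1)·C(3n, n−1), an instance of binomial-ratio.
  ballot-times : ∀ n → ballot (2 * n) n * suc (2 * n) ≡ (3 * n) C n
  ballot-times zero    = refl
  ballot-times (suc m) = +-cancelˡ-≡ (2 * (suc (2 * n) * Y)) _ _ (begin
    2 * (suc (2 * n) * Y) + F * suc (2 * n) ≡⟨ regroup n F Y ⟩
    suc (2 * n) * (F + 2 * Y)               ≡⟨ cong (suc (2 * n) *_) formula ⟩
    suc (2 * n) * X                         ≡⟨ expand n X ⟩
    2 * (n * X) + X                         ≡⟨ cong (λ z → 2 * z + X) ratio ⟩
    2 * (suc (2 * n) * Y) + X               ∎)
    where
    n = suc m
    F = ballot (2 * n) n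
    X = (3 * n) C n
    Y = (3 * n) C m
    thrice : ∀ m → 2 * suc m + suc m ≡ 3 * suc m
    thrice = solve-∀
    thrice′ : ∀ m → m + suc (2 * suc m) ≡ 3 * suc m
    thrice′ = solve-∀
    formula : F + 2 * Y ≡ X
    formula = subst (λ N → F + 2 * (N C m) ≡ N C n) (thrice m) (ballot-formula (2 * n) n (n≤1+n _))
    ratio : n * X ≡ suc (2 * n) * Y
    ratio = subst (λ N → n * (N C n) ≡ suc (2 * n) * (N C m)) (thrice′ m) (binomial-ratio m (suc (2 * n)))
    regroup : ∀ n F Y → 2 * (suc (2 * n) * Y) + F * suc (2 * n) ≡ suc (2 * n) * (F + 2 * Y)
    regroup = solve-∀
    expand : ∀ n X → suc (2 * n) * X ≡ 2 * (n * X) + X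
    expand = solve-∀

  ballot-closed-form : ∀ n → ballot (2 * n) n ≡ ((3 * n) C n) / suc (2 * n)
  ballot-closed-form n =
    trans (sym (m*n/n≡m (ballot (2 * n) n) (suc (2 * n)))) (cong (_/ suc (2 * n)) (ballot-times n))

module Arrangements where

  open BallotNumbers using (onlyIf; ballot)

  Descending : List ℕ → Set
  Descending = AllPairs (λ x y → y < x)

  -- Doubling by recursion, matching the two leaves consumed per root.
  double : ℕ → ℕ
  double zero    = zero
  double (suc k) = suc (suc (double k))

  double≡2* : ∀ k → double k ≡ 2 * k
  double≡2* zero    = refl
  double≡2* (suc k) = trans (cong (suc ∘ suc) (double≡2* k)) (sym (*-suc 2 k))

  RootsBelowLeaves : List ℕ → List ℕ → Set
  RootsBelowLeaves []      L           = ⊤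
  RootsBelowLeaves (x ∷ R) (y ∷ z ∷ L) = x < y × x < z × RootsBelowLeaves R L
  RootsBelowLeaves (x ∷ R) _           = ⊥

  -- These are
  -- exactly the root and leaf sequences of the permutations being counted.
  record Admissible (a r : ℕ) (R L : List ℕ) : Set where
    field
      #roots   : length R ≡ r
      #leaves  : length L ≡ a
      roots↓   : Descending R
      leaves↓  : Descending L
      roots<   : All (_< a + r) R
      leaves<  : All (_< a + r) L
      covers   : ∀ v → v < a + r → v ∈ R ⊎ v ∈ L
      disjoint : ∀ v → v ∈ R → v ∈ L → ⊥
      below    : RootsBelowLeaves R L

  -- A candidate arrangement: (root values, leaf values).
  Pair : Set
  Pair = List ℕ × List ℕ

  pushLeaf : Pair → Pair
  pushLeaf (R , L) = map suc R , map suc L ++ [ 0 ]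

  pushRoot : Pair → Pair
  pushRoot (R , L) = map suc R ++ [ 0 ] , map suc L

  keepIf : {P A : Set} → Dec P → List A → List A
  keepIf (yes _) xs = xs
  keepIf (no _)  _  = []

  pairs : ℕ → ℕ → List Pair
  pairs zero    zero    = [ ([] , []) ]
  pairs (suc a) zero    = map pushLeaf (pairs a zero)
  pairs zero    (suc r) = []
  pairs (suc a) (suc r) =
    map pushLeaf (pairs a (suc r)) ++ keepIf (2 * suc r ≤? suc a) (map pushRoot (pairs (suc a) r))

  length-pairs : ∀ a r → length (pairs a r) ≡ ballot a r
  length-pairs zero    zero    = refl
  length-pairs (suc a) zero    = trans (length-map pushLeaf (pairs a zero)) (length-pairs a zero)
  length-pairs zero    (suc r) = refl
  length-pairs (suc a) (suc r) = trans (length-++ (map pushLeaf (pairs a (suc r))))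
    (cong₂ _+_ (trans (length-map pushLeaf (pairs a (suc r))) (length-pairs a (suc r)))
               (length-keepIf (2 * suc r ≤? suc a)))
    where
    length-keepIf : {P : Set} (d : Dec P) →
                    length (keepIf d (map pushRoot (pairs (suc a) r))) ≡ onlyIf d (ballot (suc a) r)
    length-keepIf (yes _) = trans (length-map pushRoot (pairs (suc a) r)) (length-pairs (suc a) r)
    length-keepIf (no _)  = refl

  -- Uniqueness of the enumeration: the two pushes are injective with disjoint images.

  0∉shift : ∀ L → 0 ∉ map suc L
  0∉shift (x ∷ L) (here ())
  0∉shift (x ∷ L) (there m) = 0∉shift L m

  ∈-shift⁻ : ∀ {u L} → suc u ∈ map suc L → u ∈ L
  ∈-shift⁻ m with ∈-map⁻ suc m
  ... | _ , m′ , refl = m′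

  pushLeaf-injective : ∀ {p q} → pushLeaf p ≡ pushLeaf q → p ≡ q
  pushLeaf-injective {R , L} {R′ , L′} e = cong₂ _,_
    (map-injective suc-injective (cong proj₁ e))
    (map-injective suc-injective (∷ʳ-injectiveˡ (map suc L) (map suc L′) (cong proj₂ e)))

  pushRoot-injective : ∀ {p q} → pushRoot p ≡ pushRoot q → p ≡ q
  pushRoot-injective {R , L} {R′ , L′} e = cong₂ _,_
    (map-injective suc-injective (∷ʳ-injectiveˡ (map suc R) (map suc R′) (cong proj₁ e)))
    (map-injective suc-injective (cong proj₂ e))

  pushLeaf≢pushRoot : ∀ p q → pushLeaf p ≢ pushRoot q
  pushLeaf≢pushRoot (R , L) (R′ , L′) e =
    0∉shift R (subst (0 ∈_) (sym (cong proj₁ e)) (∈-++⁺ʳ (map suc R′) (here refl)))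

  pairs-unique : ∀ a r → Unique (pairs a r)
  pairs-unique zero    zero    = [] ∷ []
  pairs-unique (suc a) zero    = UniqueP.map⁺ pushLeaf-injective (pairs-unique a zero)
  pairs-unique zero    (suc r) = []
  pairs-unique (suc a) (suc r) = UniqueP.++⁺
    (UniqueP.map⁺ pushLeaf-injective (pairs-unique a (suc r)))
    (keepIf-unique (2 * suc r ≤? suc a))
    (λ (m , m′) → separated (2 * suc r ≤? suc a) m m′)
    where
    roots-part = map pushRoot (pairs (suc a) r)
    keepIf-unique : {P : Set} (d : Dec P) → Unique (keepIf d roots-part)
    keepIf-unique (yes _) = UniqueP.map⁺ pushRoot-injective (pairs-unique (suc a) r)
    keepIf-unique (no _)  = []
    separated : {P : Set} (d : Dec P) {p : Pair} →
                p ∈ map pushLeaf (pairs a (suc r)) → p ∈ keepIf d roots-part → ⊥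
    separated (yes _) m m′ with ∈-map⁻ pushLeaf m | ∈-map⁻ pushRoot m′
    ... | q , _ , refl | q′ , _ , e = pushLeaf≢pushRoot q q′ e

  descending-shift : ∀ {L} → Descending L → Descending (map suc L)
  descending-shift d = AllPairsP.map⁺ (AllPairs.map s≤s d)

  descending-unshift : ∀ {L} → Descending (map suc L) → Descending L
  descending-unshift d = AllPairs.map ≤-pred (AllPairsP.map⁻ d)

  descending-snoc0 : ∀ {L} → Descending L → Descending (map suc L ++ [ 0 ])
  descending-snoc0 {L} d = AllPairsP.++⁺ (descending-shift d) ([] ∷ [])
    (AllP.gmap⁺ (λ _ → s≤s z≤n ∷ []) (All.universal (λ _ → tt) L))

  descending-unsnoc : ∀ {L z} → Descending (L ++ [ z ]) → Descending L
  descending-unsnoc {[]}    _        = []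
  descending-unsnoc {x ∷ L} (p ∷ ps) = AllP.++⁻ˡ L p ∷ descending-unsnoc ps

  descending-zero : ∀ {L} → Descending L → 0 ∈ L → ∃ λ L′ → L ≡ map suc L′ ++ [ 0 ]
  descending-zero {zero ∷ []}    _                 _         = [] , refl
  descending-zero {zero ∷ y ∷ L} ((() ∷ _) ∷ _)    _
  descending-zero {suc x ∷ L}    _                 (here ())
  descending-zero {suc x ∷ L}    (_ ∷ d)           (there m) =
    let (L′ , e) = descending-zero d m in x ∷ L′ , cong (suc x ∷_) e

  zero-free : ∀ {L} → 0 ∉ L → ∃ λ L′ → L ≡ map suc L′
  zero-free {[]}        _  = [] , refl
  zero-free {zero ∷ L}  0∉ = ⊥-elim (0∉ (here refl))
  zero-free {suc x ∷ L} 0∉ = let (L′ , e) = zero-free (0∉ ∘ there) in x ∷ L′ , cong (suc x ∷_) e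

  shift-below : ∀ R L ys → RootsBelowLeaves R L → RootsBelowLeaves (map suc R) (map suc L ++ ys)
  shift-below []      L           ys _           = tt
  shift-below (x ∷ R) (y ∷ z ∷ L) ys (p , q , s) = s≤s p , s≤s q , shift-below R L ys s

  unshift-below : ∀ R L → RootsBelowLeaves (map suc R) (map suc L ++ [ 0 ]) → RootsBelowLeaves R L
  unshift-below []      L           _           = tt
  unshift-below (x ∷ R) []          ()
  unshift-below (x ∷ R) (y ∷ [])    (_ , () , _)
  unshift-below (x ∷ R) (y ∷ z ∷ L) (p , q , s) = ≤-pred p , ≤-pred q , unshift-below R L s

  pushRoot-below : ∀ R L → RootsBelowLeaves R L → suc (suc (double (length R))) ≤ length L →
                   RootsBelowLeaves (map suc R ++ [ 0 ]) (map suc L)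
  pushRoot-below []      (y ∷ z ∷ L) _           _  = s≤s z≤n , s≤s z≤n , tt
  pushRoot-below []      (y ∷ [])    _           (s≤s ())
  pushRoot-below (x ∷ R) (y ∷ z ∷ L) (p , q , s) le = s≤s p , s≤s q , pushRoot-below R L s (≤-pred (≤-pred le))

  popRoot-below : ∀ R L → RootsBelowLeaves (map suc R ++ [ 0 ]) (map suc L) → RootsBelowLeaves R L
  popRoot-below []      L           _           = tt
  popRoot-below (x ∷ R) (y ∷ z ∷ L) (p , q , s) = ≤-pred p , ≤-pred q , popRoot-below R L s

  leaves-suffice : ∀ R L → RootsBelowLeaves R L → double (length R) ≤ length L
  leaves-suffice []      L           _           = z≤n
  leaves-suffice (x ∷ R) (y ∷ z ∷ L) (_ , _ , s) = s≤s (s≤s (leaves-suffice R L s))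

  roots-need-leaves : ∀ {a r R L} → Admissible a r R L → 2 * r ≤ a
  roots-need-leaves {a} {r} {R} {L} adm = subst₂ _≤_
    (trans (cong double #roots) (double≡2* r)) #leaves (leaves-suffice R L below)
    where open Admissible adm

  length-snoc : ∀ (L : List ℕ) z → length (L ++ [ z ]) ≡ suc (length L)
  length-snoc L z = trans (length-++ L) (+-comm (length L) 1)

  pushLeaf-admissible : ∀ {a r R L} → Admissible a r R L →
                        Admissible (suc a) r (map suc R) (map suc L ++ [ 0 ])
  pushLeaf-admissible {a} {r} {R} {L} adm = record
    { #roots   = trans (length-map suc R) #roots
    ; #leaves  = trans (length-snoc (map suc L) 0) (cong suc (trans (length-map suc L) #leaves))
    ; roots↓   = descending-shift roots↓
    ; leaves↓  = descending-snoc0 leaves↓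
    ; roots<   = AllP.gmap⁺ s≤s roots<
    ; leaves<  = AllP.++⁺ (AllP.gmap⁺ s≤s leaves<) (s≤s z≤n ∷ [])
    ; covers   = covers′
    ; disjoint = disjoint′
    ; below    = shift-below R L [ 0 ] below
    }
    where
    open Admissible adm
    covers′ : ∀ v → v < suc a + r → v ∈ map suc R ⊎ v ∈ map suc L ++ [ 0 ]
    covers′ zero    _  = inj₂ (∈-++⁺ʳ (map suc L) (here refl))
    covers′ (suc v) lt = Sum.map (∈-map⁺ suc) (∈-++⁺ˡ ∘ ∈-map⁺ suc) (covers v (≤-pred lt))
    disjoint′ : ∀ v → v ∈ map suc R → v ∈ map suc L ++ [ 0 ] → ⊥
    disjoint′ zero    m _  = 0∉shift R m
    disjoint′ (suc v) m m′ with ∈-++⁻ (map suc L) m′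
    ... | inj₁ m″       = disjoint v (∈-shift⁻ m) (∈-shift⁻ m″)
    ... | inj₂ (here ())

  pushLeaf-admissible⁻ : ∀ {a r R L} → Admissible (suc a) r (map suc R) (map suc L ++ [ 0 ]) →
                         Admissible a r R L
  pushLeaf-admissible⁻ {a} {r} {R} {L} adm = record
    { #roots   = trans (sym (length-map suc R)) #roots
    ; #leaves  = suc-injective (trans (cong suc (sym (length-map suc L)))
                                      (trans (sym (length-snoc (map suc L) 0)) #leaves))
    ; roots↓   = descending-unshift roots↓
    ; leaves↓  = descending-unshift (descending-unsnoc leaves↓)
    ; roots<   = AllP.gmap⁻ ≤-pred roots<
    ; leaves<  = AllP.gmap⁻ ≤-pred (AllP.++⁻ˡ (map suc L) leaves<)
    ; covers   = covers′
    ; disjoint = λ v m m′ → disjoint (suc v) (∈-map⁺ suc m) (∈-++⁺ˡ (∈-map⁺ suc m′))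
    ; below    = unshift-below R L below
    }
    where
    open Admissible adm
    covers′ : ∀ v → v < a + r → v ∈ R ⊎ v ∈ L
    covers′ v lt with covers (suc v) (s≤s lt)
    ... | inj₁ m = inj₁ (∈-shift⁻ m)
    ... | inj₂ m with ∈-++⁻ (map suc L) m
    ...   | inj₁ m′       = inj₂ (∈-shift⁻ m′)
    ...   | inj₂ (here ())

  pushRoot-admissible : ∀ {a r R L} → Admissible a r R L → 2 * suc r ≤ a →
                        Admissible a (suc r) (map suc R ++ [ 0 ]) (map suc L)
  pushRoot-admissible {a} {r} {R} {L} adm room = record
    { #roots   = trans (length-snoc (map suc R) 0) (cong suc (trans (length-map suc R) #roots))
    ; #leaves  = trans (length-map suc L) #leaves
    ; roots↓   = descending-snoc0 roots↓
    ; leaves↓  = descending-shift leaves↓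
    ; roots<   = AllP.++⁺ (AllP.gmap⁺ raise roots<) (≤-trans (s≤s z≤n) (m≤n+m (suc r) a) ∷ [])
    ; leaves<  = AllP.gmap⁺ raise leaves<
    ; covers   = covers′
    ; disjoint = disjoint′
    ; below    = pushRoot-below R L below (subst₂ _≤_ lengths (sym #leaves) room)
    }
    where
    open Admissible adm
    raise : ∀ {v} → v < a + r → suc v < a + suc r
    raise {v} lt = subst (suc v <_) (sym (+-suc a r)) (s≤s lt)
    lengths : 2 * suc r ≡ suc (suc (double (length R)))
    lengths = sym (trans (cong (suc ∘ suc ∘ double) #roots) (double≡2* (suc r)))
    covers′ : ∀ v → v < a + suc r → v ∈ map suc R ++ [ 0 ] ⊎ v ∈ map suc L
    covers′ zero    _  = inj₁ (∈-++⁺ʳ (map suc R) (here refl))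
    covers′ (suc v) lt = Sum.map (∈-++⁺ˡ ∘ ∈-map⁺ suc) (∈-map⁺ suc)
                                 (covers v (≤-pred (subst (suc v <_) (+-suc a r) lt)))
    disjoint′ : ∀ v → v ∈ map suc R ++ [ 0 ] → v ∈ map suc L → ⊥
    disjoint′ zero    _ m′ = 0∉shift L m′
    disjoint′ (suc v) m m′ with ∈-++⁻ (map suc R) m
    ... | inj₁ m″       = disjoint v (∈-shift⁻ m″) (∈-shift⁻ m′)
    ... | inj₂ (here ())

  pushRoot-admissible⁻ : ∀ {a r R L} → Admissible a (suc r) (map suc R ++ [ 0 ]) (map suc L) →
                         Admissible a r R L
  pushRoot-admissible⁻ {a} {r} {R} {L} adm = record
    { #roots   = suc-injective (trans (cong suc (sym (length-map suc R)))
                                      (trans (sym (length-snoc (map suc R) 0)) #roots))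
    ; #leaves  = trans (sym (length-map suc L)) #leaves
    ; roots↓   = descending-unshift (descending-unsnoc roots↓)
    ; leaves↓  = descending-unshift leaves↓
    ; roots<   = AllP.gmap⁻ lower (AllP.++⁻ˡ (map suc R) roots<)
    ; leaves<  = AllP.gmap⁻ lower leaves<
    ; covers   = covers′
    ; disjoint = λ v m m′ → disjoint (suc v) (∈-++⁺ˡ (∈-map⁺ suc m)) (∈-map⁺ suc m′)
    ; below    = popRoot-below R L below
    }
    where
    open Admissible adm
    lower : ∀ {v} → suc v < a + suc r → v < a + r
    lower {v} lt = ≤-pred (subst (suc v <_) (+-suc a r) lt)
    covers′ : ∀ v → v < a + r → v ∈ R ⊎ v ∈ L
    covers′ v lt with covers (suc v) (subst (suc v <_) (sym (+-suc a r)) (s≤s lt))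
    ... | inj₂ m = inj₂ (∈-shift⁻ m)
    ... | inj₁ m with ∈-++⁻ (map suc R) m
    ...   | inj₁ m′       = inj₁ (∈-shift⁻ m′)
    ...   | inj₂ (here ())

  AdmissiblePair : ℕ → ℕ → Pair → Set
  AdmissiblePair a r (R , L) = Admissible a r R L

  pairs-sound : ∀ a r → All (AdmissiblePair a r) (pairs a r)
  pairs-sound zero    zero    = empty ∷ []
    where
    empty : Admissible 0 0 [] []
    empty = record
      { #roots = refl ; #leaves = refl ; roots↓ = [] ; leaves↓ = [] ; roots< = [] ; leaves< = []
      ; covers = λ _ () ; disjoint = λ _ () ; below = tt }
  pairs-sound (suc a) zero    = AllP.gmap⁺ pushLeaf-admissible (pairs-sound a zero)
  pairs-sound zero    (suc r) = []
  pairs-sound (suc a) (suc r) =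
    AllP.++⁺ (AllP.gmap⁺ pushLeaf-admissible (pairs-sound a (suc r))) (root-part (2 * suc r ≤? suc a))
    where
    root-part : (d : Dec (2 * suc r ≤ suc a)) →
                All (AdmissiblePair (suc a) (suc r)) (keepIf d (map pushRoot (pairs (suc a) r)))
    root-part (yes room) = AllP.gmap⁺ (λ adm → pushRoot-admissible adm room) (pairs-sound (suc a) r)
    root-part (no _)     = []

  pushLeaf-∈-pairs : ∀ a r {q} → q ∈ pairs a r → pushLeaf q ∈ pairs (suc a) r
  pushLeaf-∈-pairs a zero    m = ∈-map⁺ pushLeaf m
  pushLeaf-∈-pairs a (suc r) m = ∈-++⁺ˡ (∈-map⁺ pushLeaf m)

  pushRoot-∈-pairs : ∀ a r {q} → 2 * suc r ≤ suc a → q ∈ pairs (suc a) r →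
                     pushRoot q ∈ pairs (suc a) (suc r)
  pushRoot-∈-pairs a r room m with 2 * suc r ≤? suc a
  ... | yes _    = ∈-++⁺ʳ (map pushLeaf (pairs a (suc r))) (∈-map⁺ pushRoot m)
  ... | no  full = ⊥-elim (full room)

  leaf-step : ∀ {a r R L} → Admissible (suc a) r R L → 0 ∈ L →
              (∀ {R′ L′} → Admissible a r R′ L′ → (R′ , L′) ∈ pairs a r) →
              (R , L) ∈ pairs (suc a) r
  leaf-step {a} {r} adm m complete
    with descending-zero (Admissible.leaves↓ adm) m | zero-free (λ m′ → Admissible.disjoint adm 0 m′ m)
  ... | L′ , refl | R′ , refl = pushLeaf-∈-pairs a r (complete (pushLeaf-admissible⁻ adm))

  root-step : ∀ {a r R L} → Admissible (suc a) (suc r) R L → 0 ∈ R →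
              (∀ {R′ L′} → Admissible (suc a) r R′ L′ → (R′ , L′) ∈ pairs (suc a) r) →
              (R , L) ∈ pairs (suc a) (suc r)
  root-step {a} {r} adm m complete
    with descending-zero (Admissible.roots↓ adm) m | zero-free (λ m′ → Admissible.disjoint adm 0 m m′)
  ... | R′ , refl | L′ , refl =
    pushRoot-∈-pairs a r (roots-need-leaves adm) (complete (pushRoot-admissible⁻ adm))

  pairs-complete : ∀ a r {R L} → Admissible a r R L → (R , L) ∈ pairs a r
  pairs-complete zero    zero    {[]}    {[]}    _   = here refl
  pairs-complete zero    zero    {_ ∷ _}         adm = ⊥-elim (1+n≢0 (Admissible.#roots adm))
  pairs-complete zero    zero    {[]}    {_ ∷ _} adm = ⊥-elim (1+n≢0 (Admissible.#leaves adm))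
  pairs-complete zero    (suc r) adm =
    ⊥-elim (n≮0 (≤-trans (≤-reflexive (sym (*-suc 2 r))) (roots-need-leaves adm)))
  pairs-complete (suc a) zero    {_ ∷ _} adm = ⊥-elim (1+n≢0 (Admissible.#roots adm))
  pairs-complete (suc a) zero    {[]}    adm =
    Sum.[ (λ ()) , (λ m → leaf-step adm m (pairs-complete a zero)) ]′ (Admissible.covers adm 0 (s≤s z≤n))
  pairs-complete (suc a) (suc r) adm =
    Sum.[ (λ m → root-step adm m (pairs-complete (suc a) r))
        , (λ m → leaf-step adm m (pairs-complete a (suc r))) ]′ (Admissible.covers adm 0 (s≤s z≤n))

module ShrubLists where

  open Arrangements using (Descending; RootsBelowLeaves; double)

  interleave : List ℕ → List ℕ → List ℕ
  interleave (x ∷ R) (y ∷ z ∷ L) = x ∷ y ∷ z ∷ interleave R L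
  interleave _       L           = L

  roots : List ℕ → List ℕ
  roots (x ∷ y ∷ z ∷ L) = x ∷ roots L
  roots _               = []

  leaves : List ℕ → List ℕ
  leaves (x ∷ y ∷ z ∷ L) = y ∷ z ∷ leaves L
  leaves _               = []

  ShrubList : List ℕ → Set
  ShrubList []              = ⊤
  ShrubList (x ∷ y ∷ z ∷ L) = x < y × x < z × ShrubList L
  ShrubList _               = ⊥

  data Has12 (x : ℕ) : List ℕ → Set where
    here₁₂  : ∀ {y L} → x < y → Any (y <_) L → Has12 x (y ∷ L)
    there₁₂ : ∀ {y L} → Has12 x L → Has12 x (y ∷ L)

  data Has123 : List ℕ → Set where
    here₁₂₃  : ∀ {x L} → Has12 x L → Has123 (x ∷ L)
    there₁₂₃ : ∀ {x L} → Has123 L → Has123 (x ∷ L)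

  ∈-interleave⁻ : ∀ R L {v} → v ∈ interleave R L → v ∈ R ⊎ v ∈ L
  ∈-interleave⁻ (x ∷ R) (y ∷ z ∷ L) (here e)                 = inj₁ (here e)
  ∈-interleave⁻ (x ∷ R) (y ∷ z ∷ L) (there (here e))         = inj₂ (here e)
  ∈-interleave⁻ (x ∷ R) (y ∷ z ∷ L) (there (there (here e))) = inj₂ (there (here e))
  ∈-interleave⁻ (x ∷ R) (y ∷ z ∷ L) (there (there (there m))) =
    Sum.map there (there ∘ there) (∈-interleave⁻ R L m)
  ∈-interleave⁻ []          L       m = inj₂ m
  ∈-interleave⁻ (x ∷ R)     []      m = inj₂ m
  ∈-interleave⁻ (x ∷ R)     (y ∷ []) m = inj₂ m

  All-interleave : ∀ {P : ℕ → Set} R L → All P R → All P L → All P (interleave R L)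
  All-interleave R L pR pL = All.tabulate (Sum.[ All.lookup pR , All.lookup pL ]′ ∘ ∈-interleave⁻ R L)

  descending-unique : ∀ {L} → Descending L → Unique L
  descending-unique = AllPairs.map >⇒≢

  interleave-unique : ∀ R L → Descending R → Descending L → (∀ v → v ∈ R → v ∈ L → ⊥) →
                      Unique (interleave R L)
  interleave-unique (x ∷ R) (y ∷ z ∷ L) (x>R ∷ dR) (y>zL ∷ z>L ∷ dL) disj =
    (x≢ (here refl) ∷ x≢ (there (here refl)) ∷ All.tabulate (λ m → x≢rest m)) ∷
    (>⇒≢ (All.head y>zL) ∷ All.tabulate (λ m → leaf≢rest (here refl) (All.tail y>zL) m)) ∷
    All.tabulate (λ m → leaf≢rest (there (here refl)) z>L m) ∷
    interleave-unique R L dR dL (λ v m m′ → disj v (there m) (there (there m′)))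
    where
    x≢ : ∀ {v} → v ∈ y ∷ z ∷ L → x ≢ v
    x≢ m refl = disj x (here refl) m
    x≢rest : ∀ {v} → v ∈ interleave R L → x ≢ v
    x≢rest m = Sum.[ (λ mR → >⇒≢ (All.lookup x>R mR)) , (λ mL → x≢ (there (there mL))) ]′ (∈-interleave⁻ R L m)
    leaf≢rest : ∀ {u v} → u ∈ y ∷ z ∷ L → All (_< u) L → v ∈ interleave R L → u ≢ v
    leaf≢rest mu u>L m refl =
      Sum.[ (λ mR → disj _ (there mR) mu) , (λ mL → >⇒≢ (All.lookup u>L mL) refl) ]′ (∈-interleave⁻ R L m)
  interleave-unique []      L       _ dL _ = descending-unique dL
  interleave-unique (x ∷ R) []      _ dL _ = descending-unique dL
  interleave-unique (x ∷ R) (y ∷ []) _ dL _ = descending-unique dL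

  none-above : ∀ {y L} → All (_< y) L → ¬ Any (y <_) L
  none-above (p ∷ _)  (here q)  = <-asym p q
  none-above (_ ∷ ps) (there h) = none-above ps h

  Has12⇒Any : ∀ {x L} → Has12 x L → Any (x <_) L
  Has12⇒Any (here₁₂ p _) = here p
  Has12⇒Any (there₁₂ h)  = there (Has12⇒Any h)

  descending-no-12 : ∀ {x L} → Descending L → ¬ Has12 x L
  descending-no-12 (p ∷ _)  (here₁₂ _ above) = none-above p above
  descending-no-12 (_ ∷ ps) (there₁₂ h)      = descending-no-12 ps h

  descending-no-123 : ∀ {L} → Descending L → ¬ Has123 L
  descending-no-123 (_ ∷ ps) (here₁₂₃ h)  = descending-no-12 ps h
  descending-no-123 (_ ∷ ps) (there₁₂₃ h) = descending-no-123 ps h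

  no-12-above : ∀ x R L → All (_< x) R → Descending R → Descending L → RootsBelowLeaves R L →
                ¬ Has12 x (interleave R L)
  no-12-above x []      L           _          _        dL                  _ h = descending-no-12 dL h
  no-12-above x (r ∷ R) (y ∷ z ∷ L) (r<x ∷ R<x) (_ ∷ dR) (y>zL ∷ z>L ∷ dL) (_ , _ , below) = go
    where
    go : Has12 x (r ∷ y ∷ z ∷ interleave R L) → ⊥
    go (here₁₂ x<r _) = <-asym x<r r<x
    go (there₁₂ (here₁₂ x<y above)) = none-above
      (All.head y>zL ∷ All-interleave R L (All.map (λ q → <-trans q x<y) R<x) (All.tail y>zL)) above
    go (there₁₂ (there₁₂ (here₁₂ x<z above))) = none-above
      (All-interleave R L (All.map (λ q → <-trans q x<z) R<x) z>L) above
    go (there₁₂ (there₁₂ (there₁₂ h))) = no-12-above x R L R<x dR dL below h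

  interleave-avoids-123 : ∀ R L → Descending R → Descending L → RootsBelowLeaves R L →
                          ¬ Has123 (interleave R L)
  interleave-avoids-123 []      L           _          dL                  _ = descending-no-123 dL
  interleave-avoids-123 (x ∷ R) (y ∷ z ∷ L) (x>R ∷ dR) (y>zL ∷ z>L ∷ dL) (x<y , x<z , below) = go
    where
    after-y : All (_< y) (z ∷ interleave R L)
    after-y = All.head y>zL ∷ All-interleave R L (All.map (λ q → <-trans q x<y) x>R) (All.tail y>zL)
    after-z : All (_< z) (interleave R L)
    after-z = All-interleave R L (All.map (λ q → <-trans q x<z) x>R) z>L
    go : Has123 (x ∷ y ∷ z ∷ interleave R L) → ⊥
    go (here₁₂₃ (here₁₂ _ above))           = none-above after-y above
    go (here₁₂₃ (there₁₂ (here₁₂ _ above))) = none-above after-z above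
    go (here₁₂₃ (there₁₂ (there₁₂ h)))      = no-12-above x R L x>R dR dL below h
    go (there₁₂₃ (here₁₂₃ h))               = none-above after-y (Has12⇒Any h)
    go (there₁₂₃ (there₁₂₃ (here₁₂₃ h)))    = none-above after-z (Has12⇒Any h)
    go (there₁₂₃ (there₁₂₃ (there₁₂₃ h)))   = interleave-avoids-123 R L dR dL below h

  length-interleave : ∀ R L → RootsBelowLeaves R L → length (interleave R L) ≡ length R + length L
  length-interleave []      L           _           = refl
  length-interleave (x ∷ R) (y ∷ z ∷ L) (_ , _ , s) = cong suc (begin
    suc (suc (length (interleave R L))) ≡⟨ cong (suc ∘ suc) (length-interleave R L s) ⟩
    suc (suc (length R + length L))     ≡⟨ cong suc (+-suc (length R) (length L)) ⟨
    suc (length R + suc (length L))     ≡⟨ +-suc (length R) (suc (length L)) ⟨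
    length R + suc (suc (length L))     ∎)
    where open ≡-Reasoning

  interleave-shrub : ∀ R L → RootsBelowLeaves R L → length L ≡ double (length R) →
                     ShrubList (interleave R L)
  interleave-shrub []      []          _           _ = tt
  interleave-shrub (x ∷ R) (y ∷ z ∷ L) (p , q , s) e =
    p , q , interleave-shrub R L s (suc-injective (suc-injective e))

  roots-interleave : ∀ R L → RootsBelowLeaves R L → length L ≡ double (length R) →
                     roots (interleave R L) ≡ R
  roots-interleave []      []          _           _ = refl
  roots-interleave (x ∷ R) (y ∷ z ∷ L) (_ , _ , s) e =
    cong (x ∷_) (roots-interleave R L s (suc-injective (suc-injective e)))

  leaves-interleave : ∀ R L → RootsBelowLeaves R L → length L ≡ double (length R) →
                      leaves (interleave R L) ≡ L
  leaves-interleave []      []          _           _ = refl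
  leaves-interleave (x ∷ R) (y ∷ z ∷ L) (_ , _ , s) e =
    cong (λ L′ → y ∷ z ∷ L′) (leaves-interleave R L s (suc-injective (suc-injective e)))

  interleave-roots-leaves : ∀ L → ShrubList L → interleave (roots L) (leaves L) ≡ L
  interleave-roots-leaves []              _           = refl
  interleave-roots-leaves (x ∷ y ∷ z ∷ L) (_ , _ , s) = cong (λ L′ → x ∷ y ∷ z ∷ L′) (interleave-roots-leaves L s)

  roots-below-leaves : ∀ L → ShrubList L → RootsBelowLeaves (roots L) (leaves L)
  roots-below-leaves []              _           = tt
  roots-below-leaves (x ∷ y ∷ z ∷ L) (p , q , s) = p , q , roots-below-leaves L s

  length-leaves : ∀ L → ShrubList L → length (leaves L) ≡ double (length (roots L))
  length-leaves []              _           = refl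
  length-leaves (x ∷ y ∷ z ∷ L) (_ , _ , s) = cong (suc ∘ suc) (length-leaves L s)

  length-roots : ∀ n L → ShrubList L → length L ≡ 3 * n → length (roots L) ≡ n
  length-roots zero    []              _           _ = refl
  length-roots (suc n) (x ∷ y ∷ z ∷ L) (_ , _ , s) e =
    cong suc (length-roots n L s (suc-injective (suc-injective (suc-injective (trans e (*-suc 3 n))))))

  ∈-roots : ∀ L {v} → v ∈ roots L → v ∈ L
  ∈-roots (x ∷ y ∷ z ∷ L) (here e)  = here e
  ∈-roots (x ∷ y ∷ z ∷ L) (there m) = there (there (there (∈-roots L m)))

  ∈-leaves : ∀ L {v} → v ∈ leaves L → v ∈ L
  ∈-leaves (x ∷ y ∷ z ∷ L) (here e)          = there (here e)
  ∈-leaves (x ∷ y ∷ z ∷ L) (there (here e))  = there (there (here e))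
  ∈-leaves (x ∷ y ∷ z ∷ L) (there (there m)) = there (there (there (∈-leaves L m)))

  ∈-roots-or-leaves : ∀ L {v} → ShrubList L → v ∈ L → v ∈ roots L ⊎ v ∈ leaves L
  ∈-roots-or-leaves (x ∷ y ∷ z ∷ L) _ (here e)                 = inj₁ (here e)
  ∈-roots-or-leaves (x ∷ y ∷ z ∷ L) _ (there (here e))         = inj₂ (here e)
  ∈-roots-or-leaves (x ∷ y ∷ z ∷ L) _ (there (there (here e))) = inj₂ (there (here e))
  ∈-roots-or-leaves (x ∷ y ∷ z ∷ L) (_ , _ , s) (there (there (there m))) =
    Sum.map there (there ∘ there) (∈-roots-or-leaves L s m)

  roots-leaves-disjoint : ∀ L → ShrubList L → Unique L → ∀ v → v ∈ roots L → v ∈ leaves L → ⊥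
  roots-leaves-disjoint (x ∷ y ∷ z ∷ L) (_ , _ , s) ((x≢y ∷ x≢z ∷ x≢L) ∷ (_ ∷ y≢L) ∷ z≢L ∷ u) v = go
    where
    go : v ∈ x ∷ roots L → v ∈ y ∷ z ∷ leaves L → ⊥
    go (here refl) (here e)          = x≢y e
    go (here refl) (there (here e))  = x≢z e
    go (here refl) (there (there m)) = All.lookup x≢L (∈-leaves L m) refl
    go (there m)   (here refl)       = All.lookup y≢L (∈-roots L m) refl
    go (there m)   (there (here refl)) = All.lookup z≢L (∈-roots L m) refl
    go (there m)   (there (there m′)) = roots-leaves-disjoint L s u v m m′

  -- A root above x starts a 12 above x (with one of its leaves).
  root-has-12 : ∀ {x v} L → ShrubList L → v ∈ roots L → x < v → Has12 x L
  root-has-12 (y ∷ _ ∷ _ ∷ L) (p , _ , _) (here refl) x<v = here₁₂ x<v (here p)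
  root-has-12 (_ ∷ _ ∷ _ ∷ L) (_ , _ , s) (there m)   x<v = there₁₂ (there₁₂ (there₁₂ (root-has-12 L s m x<v)))

  ≢∧≮⇒> : ∀ {x v} → x ≢ v → ¬ (x < v) → v < x
  ≢∧≮⇒> x≢v x≮v = ≤∧≢⇒< (≮⇒≥ x≮v) (x≢v ∘ sym)

  roots-descending : ∀ L → ShrubList L → Unique L → ¬ Has123 L → Descending (roots L)
  roots-descending []              _           _                          _   = []
  roots-descending (x ∷ y ∷ z ∷ L) (_ , _ , s) ((_ ∷ _ ∷ x≢L) ∷ _ ∷ _ ∷ u) no123 =
    All.tabulate (λ m → ≢∧≮⇒> (All.lookup x≢L (∈-roots L m))
                              (λ x<v → no123 (here₁₂₃ (there₁₂ (there₁₂ (root-has-12 L s m x<v))))))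
    ∷ roots-descending L s u (no123 ∘ there₁₂₃ ∘ there₁₂₃ ∘ there₁₂₃)

  leaves-descending : ∀ L → ShrubList L → Unique L → ¬ Has123 L → Descending (leaves L)
  leaves-descending []              _           _                           _     = []
  leaves-descending (x ∷ y ∷ z ∷ L) (x<y , x<z , s) (_ ∷ (y≢z ∷ y≢L) ∷ z≢L ∷ u) no123 =
    (≢∧≮⇒> y≢z (λ y<z → no123 (here₁₂₃ (here₁₂ x<y (here y<z))))
     ∷ All.tabulate (λ m → ≢∧≮⇒> (All.lookup y≢L (∈-leaves L m))
         (λ y<v → no123 (here₁₂₃ (here₁₂ x<y (there (lose (∈-leaves L m) y<v)))))))
    ∷ All.tabulate (λ m → ≢∧≮⇒> (All.lookup z≢L (∈-leaves L m))
         (λ z<v → no123 (here₁₂₃ (there₁₂ (here₁₂ x<z (lose (∈-leaves L m) z<v))))))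
    ∷ leaves-descending L s u (no123 ∘ there₁₂₃ ∘ there₁₂₃ ∘ there₁₂₃)

module Words where

  open ShrubLists using (ShrubList; Has12; Has123; here₁₂; there₁₂; here₁₂₃; there₁₂₃)

  values : ∀ {m k} → Vec (Fin m) k → List ℕ
  values []      = []
  values (x ∷ w) = toℕ x ∷ values w

  length-values : ∀ {m k} (w : Vec (Fin m) k) → length (values w) ≡ k
  length-values []      = refl
  length-values (x ∷ w) = cong suc (length-values w)

  values< : ∀ {m k} (w : Vec (Fin m) k) → All (_< m) (values w)
  values< []      = []
  values< (x ∷ w) = toℕ<n x ∷ values< w

  values-∈ : ∀ {m k} (w : Vec (Fin m) k) i → toℕ (lookup w i) ∈ values w
  values-∈ (x ∷ w) Fin.zero    = here refl
  values-∈ (x ∷ w) (Fin.suc i) = there (values-∈ w i)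

  ∈-values⁻ : ∀ {m k} (w : Vec (Fin m) k) {v} → v ∈ values w → ∃ λ i → toℕ (lookup w i) ≡ v
  ∈-values⁻ (x ∷ w) (here e)  = Fin.zero , sym e
  ∈-values⁻ (x ∷ w) (there m) = let (i , e) = ∈-values⁻ w m in Fin.suc i , e

  -- Reading a list back as a word; entries out of range (never used) become 0.
  toFin : ∀ {m} → ℕ → Fin (suc m)
  toFin {m} v with v <? suc m
  ... | yes v<m = fromℕ< v<m
  ... | no  _   = Fin.zero

  toFin-toℕ : ∀ {m} (x : Fin (suc m)) → toFin (toℕ x) ≡ x
  toFin-toℕ {m} x with toℕ x <? suc m
  ... | yes x<m = fromℕ<-toℕ x x<m
  ... | no  x≮m = ⊥-elim (x≮m (toℕ<n x))

  toℕ-toFin : ∀ {m} v → v < suc m → toℕ (toFin {m} v) ≡ v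
  toℕ-toFin {m} v v<m with v <? suc m
  ... | yes v<m′ = toℕ-fromℕ< v<m′
  ... | no  v≮m  = ⊥-elim (v≮m v<m)

  fill : ∀ {m} k → List ℕ → Vec (Fin (suc m)) k
  fill zero    _       = []
  fill (suc k) []      = Fin.zero ∷ fill k []
  fill (suc k) (v ∷ L) = toFin v ∷ fill k L

  toWord : (m : ℕ) → List ℕ → Vec (Fin m) m
  toWord zero    _ = []
  toWord (suc m) L = fill (suc m) L

  values-toWord : ∀ m L → length L ≡ m → All (_< m) L → values (toWord m L) ≡ L
  values-toWord zero    []    _ _  = refl
  values-toWord (suc m) L     e bd = go (suc m) L e bd
    where
    go : ∀ k L → length L ≡ k → All (_< suc m) L → values (fill {m} k L) ≡ L
    go zero    []      _ _         = refl
    go (suc k) (v ∷ L) e (v<m ∷ bd) = cong₂ _∷_ (toℕ-toFin v v<m) (go k L (suc-injective e) bd)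

  toWord-values : ∀ m (w : Vec (Fin m) m) → toWord m (values w) ≡ w
  toWord-values zero    []  = refl
  toWord-values (suc m) w   = go (suc m) w
    where
    go : ∀ k (w : Vec (Fin (suc m)) k) → fill k (values w) ≡ w
    go zero    []      = refl
    go (suc k) (x ∷ w) = cong₂ _∷_ (toFin-toℕ x) (go k w)

  injective⇒unique : ∀ {m k} (w : Vec (Fin m) k) →
                     (∀ i j → lookup w i ≡ lookup w j → i ≡ j) → Unique (values w)
  injective⇒unique []      _   = []
  injective⇒unique (x ∷ w) inj =
    All.tabulate (λ m e → let (j , e′) = ∈-values⁻ w m in
                          FinP.0≢1+n (inj Fin.zero (Fin.suc j) (toℕ-injective (trans e (sym e′)))))
    ∷ injective⇒unique w (λ i j e → FinP.suc-injective (inj (Fin.suc i) (Fin.suc j) e))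

  unique⇒injective : ∀ {m k} (w : Vec (Fin m) k) → Unique (values w) →
                     ∀ i j → lookup w i ≡ lookup w j → i ≡ j
  unique⇒injective (x ∷ w) _          Fin.zero    Fin.zero    _ = refl
  unique⇒injective (x ∷ w) (x∉ ∷ _)  Fin.zero    (Fin.suc j) e =
    ⊥-elim (All.lookup x∉ (values-∈ w j) (cong toℕ e))
  unique⇒injective (x ∷ w) (x∉ ∷ _)  (Fin.suc i) Fin.zero    e =
    ⊥-elim (All.lookup x∉ (values-∈ w i) (cong toℕ (sym e)))
  unique⇒injective (x ∷ w) (_ ∷ u)   (Fin.suc i) (Fin.suc j) e = cong Fin.suc (unique⇒injective w u i j e)

  injective⇒surjective : ∀ {m} (h : Fin m → Fin m) → (∀ i j → h i ≡ h j → i ≡ j) →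
                         ∀ y → ∃ λ i → h i ≡ y
  injective⇒surjective {suc m} h inj y with any? (λ i → h i Fin.≟ y)
  ... | yes hit = hit
  ... | no miss = ⊥-elim (<-irrefl (cong toℕ collide) i<j)
    where
    avoid : ∀ i → y ≢ h i
    avoid i e = miss (i , sym e)
    squeeze : Fin (suc m) → Fin m
    squeeze i = Fin.punchOut (avoid i)
    clash = pigeonhole (n<1+n m) squeeze
    i = proj₁ clash
    j = proj₁ (proj₂ clash)
    i<j = proj₁ (proj₂ (proj₂ clash))
    collide : i ≡ j
    collide = inj i j (punchOut-injective (avoid i) (avoid j) (proj₂ (proj₂ (proj₂ clash))))

  perm-covers : ∀ {m} (w : Vec (Fin m) m) → IsPerm w → ∀ v → v < m → v ∈ values w
  perm-covers w perm v v<m =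
    let (i , e) = injective⇒surjective (lookup w) perm (fromℕ< v<m) in
    subst (_∈ values w) (trans (cong toℕ e) (toℕ-fromℕ< v<m)) (values-∈ w i)

  -- The pattern 123 by positions (as in Contains123, for words of any length),
  -- and its inductive counterpart on values.

  Pattern12 : ∀ {m k} → ℕ → Vec (Fin m) k → Set
  Pattern12 {m} {k} x w = Σ (Fin k) λ j → Σ (Fin k) λ l →
    (j Fin.< l) × (x < toℕ (lookup w j)) × (lookup w j Fin.< lookup w l)

  Pattern123 : ∀ {m k} → Vec (Fin m) k → Set
  Pattern123 {m} {k} w = Σ (Fin k) λ i → Σ (Fin k) λ j → Σ (Fin k) λ l →
    (i Fin.< j) × (j Fin.< l) × (lookup w i Fin.< lookup w j) × (lookup w j Fin.< lookup w l)

  pattern12⇒Has12 : ∀ {m k} (w : Vec (Fin m) k) {x} → Pattern12 x w → Has12 x (values w)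
  pattern12⇒Has12 (y ∷ w) (Fin.zero  , Fin.suc l , _        , p , q) = here₁₂ p (lose (values-∈ w l) q)
  pattern12⇒Has12 (y ∷ w) (Fin.suc j , Fin.suc l , s≤s j<l , p , q) =
    there₁₂ (pattern12⇒Has12 w (j , l , j<l , p , q))
  pattern12⇒Has12 (y ∷ w) (_         , Fin.zero  , ()       , _)

  Has12⇒pattern12 : ∀ {m k} (w : Vec (Fin m) k) {x} → Has12 x (values w) → Pattern12 x w
  Has12⇒pattern12 (y ∷ w) (here₁₂ p above) =
    let (v , m , q) = find above
        (l , e)     = ∈-values⁻ w m
    in Fin.zero , Fin.suc l , s≤s z≤n , p , subst (toℕ y <_) (sym e) q
  Has12⇒pattern12 (y ∷ w) (there₁₂ h) =
    let (j , l , j<l , p , q) = Has12⇒pattern12 w h in Fin.suc j , Fin.suc l , s≤s j<l , p , q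

  pattern123⇒Has123 : ∀ {m k} (w : Vec (Fin m) k) → Pattern123 w → Has123 (values w)
  pattern123⇒Has123 (x ∷ w) (Fin.zero  , Fin.suc j , Fin.suc l , _        , s≤s j<l , p , q) =
    here₁₂₃ (pattern12⇒Has12 w (j , l , j<l , p , q))
  pattern123⇒Has123 (x ∷ w) (Fin.suc i , Fin.suc j , Fin.suc l , s≤s i<j , s≤s j<l , p , q) =
    there₁₂₃ (pattern123⇒Has123 w (i , j , l , i<j , j<l , p , q))
  pattern123⇒Has123 (x ∷ w) (_ , Fin.zero  , _        , () , _)
  pattern123⇒Has123 (x ∷ w) (_ , Fin.suc _ , Fin.zero , _  , () , _)

  Has123⇒pattern123 : ∀ {m k} (w : Vec (Fin m) k) → Has123 (values w) → Pattern123 w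
  Has123⇒pattern123 (x ∷ w) (here₁₂₃ h) =
    let (j , l , j<l , p , q) = Has12⇒pattern12 w h in
    Fin.zero , Fin.suc j , Fin.suc l , s≤s z≤n , s≤s j<l , p , q
  Has123⇒pattern123 (x ∷ w) (there₁₂₃ h) =
    let (i , j , l , i<j , j<l , p , q) = Has123⇒pattern123 w h in
    Fin.suc i , Fin.suc j , Fin.suc l , s≤s i<j , s≤s j<l , p , q

  nth : List ℕ → ℕ → ℕ
  nth []      _       = 0
  nth (x ∷ L) zero    = x
  nth (x ∷ L) (suc i) = nth L i

  lookup-nth : ∀ {m k} (w : Vec (Fin m) k) i → toℕ (lookup w i) ≡ nth (values w) (toℕ i)
  lookup-nth (x ∷ w) Fin.zero    = refl
  lookup-nth (x ∷ w) (Fin.suc i) = lookup-nth w i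

  nth-block : ∀ x y z L i r → nth (x ∷ y ∷ z ∷ L) (3 * suc i + r) ≡ nth L (3 * i + r)
  nth-block x y z L i r = cong (nth (x ∷ y ∷ z ∷ L)) (three-more i r)
    where
    three-more : ∀ i r → 3 * suc i + r ≡ suc (suc (suc (3 * i + r)))
    three-more = solve-∀

  toℕ-pos : ∀ {n} (i : Fin n) (r : Fin 3) → toℕ (pos {n} i r) ≡ 3 * toℕ i + toℕ r
  toℕ-pos i r = trans (toℕ-cast _ (Fin.combine i r)) (toℕ-combine i r)

  ShrubAt : ℕ → List ℕ → Set
  ShrubAt n L = ∀ i → i < n → nth L (3 * i + 0) < nth L (3 * i + 1) × nth L (3 * i + 0) < nth L (3 * i + 2)

  shrub⇒ShrubAt : ∀ {n} (w : Vec (Fin (3 * n)) (3 * n)) → Shrub {n} w → ShrubAt n (values w)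
  shrub⇒ShrubAt {n} w sh i i<n = subst₂ _<_ (entry 0F) (entry 1F) p , subst₂ _<_ (entry 0F) (entry 2F) q
    where
    p = proj₁ (sh (fromℕ< i<n))
    q = proj₂ (sh (fromℕ< i<n))
    entry : ∀ r → toℕ (lookup w (pos (fromℕ< i<n) r)) ≡ nth (values w) (3 * i + toℕ r)
    entry r = trans (lookup-nth w (pos (fromℕ< i<n) r))
      (cong (nth (values w)) (trans (toℕ-pos (fromℕ< i<n) r) (cong (λ j → 3 * j + toℕ r) (toℕ-fromℕ< i<n))))

  ShrubAt⇒shrub : ∀ {n} (w : Vec (Fin (3 * n)) (3 * n)) → ShrubAt n (values w) → Shrub {n} w
  ShrubAt⇒shrub {n} w at i = subst₂ _<_ (entry 0F) (entry 1F) p , subst₂ _<_ (entry 0F) (entry 2F) q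
    where
    p = proj₁ (at (toℕ i) (toℕ<n i))
    q = proj₂ (at (toℕ i) (toℕ<n i))
    entry : ∀ r → nth (values w) (3 * toℕ i + toℕ r) ≡ toℕ (lookup w (pos i r))
    entry r = sym (trans (lookup-nth w (pos i r)) (cong (nth (values w)) (toℕ-pos i r)))

  ShrubAt⇒ShrubList : ∀ n L → length L ≡ 3 * n → ShrubAt n L → ShrubList L
  ShrubAt⇒ShrubList zero    []              _ _  = tt
  ShrubAt⇒ShrubList (suc n) (x ∷ y ∷ z ∷ L) e at =
    proj₁ (at 0 (s≤s z≤n)) , proj₂ (at 0 (s≤s z≤n)) ,
    ShrubAt⇒ShrubList n L (suc-injective (suc-injective (suc-injective (trans e (*-suc 3 n)))))
      (λ i i<n → let (p , q) = at (suc i) (s≤s i<n) in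
        subst₂ _<_ (nth-block x y z L i 0) (nth-block x y z L i 1) p ,
        subst₂ _<_ (nth-block x y z L i 0) (nth-block x y z L i 2) q)
  ShrubAt⇒ShrubList (suc n) []          e _ = ⊥-elim (0≢1+n (trans e (*-suc 3 n)))
  ShrubAt⇒ShrubList (suc n) (_ ∷ [])     e _ = ⊥-elim (0≢1+n (suc-injective (trans e (*-suc 3 n))))
  ShrubAt⇒ShrubList (suc n) (_ ∷ _ ∷ []) e _ =
    ⊥-elim (0≢1+n (suc-injective (suc-injective (trans e (*-suc 3 n)))))

  ShrubList⇒ShrubAt : ∀ n L → length L ≡ 3 * n → ShrubList L → ShrubAt n L
  ShrubList⇒ShrubAt zero    L               _ _           i       ()
  ShrubList⇒ShrubAt (suc n) []              e _           _       _ = ⊥-elim (0≢1+n (trans e (*-suc 3 n)))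
  ShrubList⇒ShrubAt (suc n) (x ∷ y ∷ z ∷ L) _ (p , q , _) zero    _ = p , q
  ShrubList⇒ShrubAt (suc n) (x ∷ y ∷ z ∷ L) e (_ , _ , s) (suc i) i<n =
    let (p , q) = ShrubList⇒ShrubAt n L (suc-injective (suc-injective (suc-injective (trans e (*-suc 3 n)))))
                                    s i (≤-pred i<n) in
    subst₂ _<_ (sym (nth-block x y z L i 0)) (sym (nth-block x y z L i 1)) p ,
    subst₂ _<_ (sym (nth-block x y z L i 0)) (sym (nth-block x y z L i 2)) q

module Correspondence (n : ℕ) where

  open Arrangements
  open ShrubLists
  open Words

  Word : Set
  Word = Vec (Fin (3 * n)) (3 * n)

  word : Pair → Word
  word (R , L) = toWord (3 * n) (interleave R L)

  split : Word → Pair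
  split w = roots (values w) , leaves (values w)

  thrice : ∀ k → 2 * k + k ≡ 3 * k
  thrice = solve-∀

  balanced : ∀ {R L} → Admissible (2 * n) n R L → length L ≡ double (length R)
  balanced adm = trans #leaves (trans (sym (double≡2* n)) (cong double (sym #roots)))
    where open Admissible adm

  values-word : ∀ {R L} → Admissible (2 * n) n R L → values (word (R , L)) ≡ interleave R L
  values-word {R} {L} adm = values-toWord (3 * n) (interleave R L)
    (trans (length-interleave R L below)
           (trans (cong₂ _+_ #roots #leaves) (trans (+-comm n (2 * n)) (thrice n))))
    (All-interleave R L (All.map (λ {v} → subst (v <_) (thrice n)) roots<)
                        (All.map (λ {v} → subst (v <_) (thrice n)) leaves<))
    where open Admissible adm

  word-valid : ∀ {p} → AdmissiblePair (2 * n) n p → InS2-123 n (word p)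
  word-valid {R , L} adm =
    unique⇒injective (word (R , L))
      (subst Unique (sym (values-word adm)) (interleave-unique R L roots↓ leaves↓ disjoint)) ,
    (λ occurrence → interleave-avoids-123 R L roots↓ leaves↓ below
                   (subst Has123 (values-word adm) (pattern123⇒Has123 (word (R , L)) occurrence))) ,
    ShrubAt⇒shrub (word (R , L)) (subst (ShrubAt n) (sym (values-word adm))
      (ShrubList⇒ShrubAt n (interleave R L) length-word (interleave-shrub R L below (balanced adm))))
    where
    open Admissible adm
    length-word : length (interleave R L) ≡ 3 * n
    length-word = trans (sym (cong length (values-word adm))) (length-values (word (R , L)))

  split-word : ∀ {p} → AdmissiblePair (2 * n) n p → split (word p) ≡ p
  split-word {R , L} adm = cong₂ _,_
    (trans (cong roots (values-word adm)) (roots-interleave R L below (balanced adm)))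
    (trans (cong leaves (values-word adm)) (leaves-interleave R L below (balanced adm)))
    where open Admissible adm

  module _ {w : Word} (valid : InS2-123 n w) where

    private
      vs = values w
      shrub : ShrubList vs
      shrub = ShrubAt⇒ShrubList n vs (length-values w) (shrub⇒ShrubAt w (proj₂ (proj₂ valid)))
      distinct : Unique vs
      distinct = injective⇒unique w (proj₁ valid)
      no-123 : ¬ Has123 vs
      no-123 = proj₁ (proj₂ valid) ∘ Has123⇒pattern123 w
      #roots : length (roots vs) ≡ n
      #roots = length-roots n vs shrub (length-values w)
      bounded : ∀ {v} → v ∈ vs → v < 2 * n + n
      bounded {v} m = subst (v <_) (sym (thrice n)) (All.lookup (values< w) m)

    split-admissible : AdmissiblePair (2 * n) n (split w)
    split-admissible = record
      { #roots   = #roots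
      ; #leaves  = trans (length-leaves vs shrub) (trans (cong double #roots) (double≡2* n))
      ; roots↓   = roots-descending vs shrub distinct no-123
      ; leaves↓  = leaves-descending vs shrub distinct no-123
      ; roots<   = All.tabulate (bounded ∘ ∈-roots vs)
      ; leaves<  = All.tabulate (bounded ∘ ∈-leaves vs)
      ; covers   = λ v v< → ∈-roots-or-leaves vs shrub
                             (perm-covers w (proj₁ valid) v (subst (v <_) (thrice n) v<))
      ; disjoint = roots-leaves-disjoint vs shrub distinct
      ; below    = roots-below-leaves vs shrub
      }

    word-split : word (split w) ≡ w
    word-split = trans (cong (toWord (3 * n)) (interleave-roots-leaves vs shrub)) (toWord-values (3 * n) w)

open BallotNumbers using (ballot-closed-form)
open Arrangements using (pairs; pairs-sound; pairs-complete; pairs-unique; length-pairs)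

corollary4 : (n : ℕ) → HasCard (InS2-123 n) (((3 * n) C n) / suc (2 * n))
corollary4 n = map word P , distinct , sound , complete , count
  where
  open Correspondence n
  P = pairs (2 * n) n
  admissible = pairs-sound (2 * n) n

  -- `split` undoes `word` on P, so `word` does not identify elements of P.
  distinct : Unique (map word P)
  distinct = UniqueP.map⁻ (subst Unique (sym split∘word) (pairs-unique (2 * n) n))
    where
    split∘word : map split (map word P) ≡ P
    split∘word = trans (sym (map-∘ P)) (map-id-local (All.map split-word admissible))

  sound : ∀ w → w ∈ map word P → InS2-123 n w
  sound w = All.lookup (AllP.gmap⁺ word-valid admissible)

  complete : ∀ w → InS2-123 n w → w ∈ map word P
  complete w valid = subst (_∈ map word P) (word-split {w} valid)
    (∈-map⁺ word (pairs-complete (2 * n) n (split-admissible {w} valid)))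

  count : length (map word P) ≡ ((3 * n) C n) / suc (2 * n)
  count = trans (length-map word P) (trans (length-pairs (2 * n) n) (ballot-closed-form n))
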